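{- Let $G$ be a graph and $S$ a vertex cut of $G$ with $|S|=s$; let $C_1,\dots,C_k$ be the components of $G-S$ and $c_i=n(C_i)$. If $G$ is recursively partitionable (respectively, arbitrarily partitionable), then the semistar $K_s(c_1,\dots,c_k)$ is recursively partitionable (respectively, arbitrarily partitionable).
   Context: For nonnegative integers $b_0,\dots,b_k$, the semistar $K_{b_0}(b_1,\dots,b_k)$ is the graph obtained from the disjoint union of cliques $K_{b_0},K_{b_1},\dots,K_{b_k}$ by adding every edge between a vertex of $K_{b_0}$ and a vertex not in $K_{b_0}$. A graph $G$ on $n$ vertices is arbitrarily partitionable (AP) if for every integer partition $a_1,\dots,a_m$ of $n$ there is a partition $\{A_1,\dots,A_m\}$ of $V(G)$ with $|A_i|=a_i$ and each $G[A_i]$ connected. $G$ is recursively partitionable (RP) if $G\simeq K_1$, or $G$ is connected and for every integer partition $a_1,\dots,a_m$ of $n$ there is such a partition with each induced subgraph $G[A_i]$ RP. -}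

module Defs where

open import Data.Nat using (ℕ; zero; suc; _+_; _∸_; _≤_; _<ᵇ_; _≡ᵇ_)
open import Data.Bool using (Bool; true; false; not; _∧_; _∨_; if_then_else_)
open import Data.Bool.Properties using (∨-comm; ∧-comm)
open import Data.Fin using (Fin; toℕ)
open import Data.Fin.Subset using (Subset; _∈_; _∉_; ∣_∣; ⊤; ∁)
open import Data.List using (List; []; _∷_; length; lookup)
open import Data.Nat.ListAction using (sum)
open import Data.List.Relation.Unary.All using (All)
open import Data.Product using (Σ; ∃; ∃-syntax; _×_; _,_)
open import Relation.Nullary using (¬_)
open import Relation.Binary.PropositionalEquality using (_≡_; refl; cong; cong₂)

record Graph (n : ℕ) : Set where
  field
    adj    : Fin n → Fin n → Bool
    sym    : ∀ u v → adj u v ≡ adj v u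
    irrefl : ∀ u → adj u u ≡ false
open Graph public

module _ {n : ℕ} (G : Graph n) where

  data Reach (A : Subset n) (u : Fin n) : Fin n → Set where
    here : u ∈ A → Reach A u u
    step : ∀ {w v} → Reach A u w → adj G w v ≡ true → v ∈ A → Reach A u v

  Connected : Subset n → Set
  Connected A = (∃[ u ] u ∈ A) × (∀ u v → u ∈ A → v ∈ A → Reach A u v)

  IsVertexCut : Subset n → Set
  IsVertexCut S = ∃[ u ] ∃[ v ] (u ∉ S × v ∉ S × ¬ Reach (∁ S) u v)

  record IsComponents (S : Subset n) (k : ℕ) (C : Fin k → Subset n) : Set where
    field
      connected : ∀ i → Connected (C i)
      avoidsS   : ∀ i v → v ∈ C i → v ∉ S
      covers    : ∀ v → v ∉ S → ∃[ i ] v ∈ C i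
      disjoint  : ∀ i j v → v ∈ C i → v ∈ C j → i ≡ j
      closed    : ∀ i u v → u ∈ C i → adj G u v ≡ true → v ∉ S → v ∈ C i

  record Realizes (A : Subset n) (as : List ℕ) (P : Subset n → Set) : Set where
    field
      part     : Fin (length as) → Subset n
      size     : ∀ i → ∣ part i ∣ ≡ lookup as i
      inA      : ∀ i v → v ∈ part i → v ∈ A
      covers   : ∀ v → v ∈ A → ∃[ i ] v ∈ part i
      disjoint : ∀ i j v → v ∈ part i → v ∈ part j → i ≡ j
      good     : ∀ i → P (part i)

  IsIntPartition : ℕ → List ℕ → Set
  IsIntPartition N as = All (1 ≤_) as × sum as ≡ N

  APon : Subset n → Set
  APon A = ∀ as → IsIntPartition ∣ A ∣ as → Realizes A as Connected

  -- The trivial one-part partition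
  -- (whose only part is A itself) is omitted since it is automatically
  -- satisfied; every other partition has strictly smaller parts.
  data RPon (A : Subset n) : Set where
    single : ∣ A ∣ ≡ 1 → RPon A
    split  : Connected A →
             (∀ as → IsIntPartition ∣ A ∣ as → 2 ≤ length as → Realizes A as RPon) →
             RPon A

AP : ∀ {n} → Graph n → Set
AP G = APon G ⊤

RP : ∀ {n} → Graph n → Set
RP G = RPon G ⊤

-- Semistar K_s(c_1,…,c_k) on vertices Fin (s + c_1 + … + c_k):
-- vertices 0..s-1 form the centre K_s; the remaining vertices are split
-- into consecutive blocks of sizes c_1, …, c_k (the cliques K_{c_i}).

blockOf : List ℕ → ℕ → ℕ
blockOf []       j = 0
blockOf (c ∷ cs) j = if j <ᵇ c then 0 else suc (blockOf cs (j ∸ c))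

private
  ≡ᵇ-sym : ∀ m n → (m ≡ᵇ n) ≡ (n ≡ᵇ m)
  ≡ᵇ-sym zero zero = refl
  ≡ᵇ-sym zero (suc n) = refl
  ≡ᵇ-sym (suc m) zero = refl
  ≡ᵇ-sym (suc m) (suc n) = ≡ᵇ-sym m n

  ≡ᵇ-refl : ∀ m → (m ≡ᵇ m) ≡ true
  ≡ᵇ-refl zero = refl
  ≡ᵇ-refl (suc m) = ≡ᵇ-refl m

semistar : (s : ℕ) (cs : List ℕ) → Graph (s + sum cs)
semistar s cs = record { adj = A ; sym = symA ; irrefl = irr }
  where
  ctr : Fin (s + sum cs) → Bool
  ctr u = toℕ u <ᵇ s
  blk : Fin (s + sum cs) → ℕ
  blk u = blockOf cs (toℕ u ∸ s)
  A : Fin (s + sum cs) → Fin (s + sum cs) → Bool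
  A u v = not (toℕ u ≡ᵇ toℕ v) ∧ (ctr u ∨ ctr v ∨ (blk u ≡ᵇ blk v))
  symA : ∀ u v → A u v ≡ A v u
  symA u v = cong₂ _∧_ (cong not (≡ᵇ-sym (toℕ u) (toℕ v))) (lem (ctr u) (ctr v))
    where
    lem : ∀ a b → (a ∨ b ∨ (blk u ≡ᵇ blk v)) ≡ (b ∨ a ∨ (blk v ≡ᵇ blk u))
    lem true true = refl
    lem true false = refl
    lem false true = refl
    lem false false = ≡ᵇ-sym (blk u) (blk v)
  irr : ∀ u → A u u ≡ false
  irr u rewrite ≡ᵇ-refl (toℕ u) = refl

{-# OPTIONS --safe #-}
module Submission where

-- Send S onto the centre of the semistar and each component C_i bijectively
-- onto the clique K_{c_i}.  This is a bijection of vertex sets that maps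
-- edges to edges: an edge of G lies inside S, between S and some C_i, or
-- inside one C_i (components are closed in G - S), and its image is then a
-- centre edge, a centre-leaf edge or a clique edge.  So G is a relabelled
-- spanning subgraph of the semistar, and adding edges preserves both RP and
-- AP: every realisation of a partition in G is one in the supergraph, with
-- the same part sizes and connected parts.

open import Defs hiding (sym)
open import Data.Nat using (ℕ; zero; suc; _+_; _∸_; _≤_; _<_; _<ᵇ_; _≡ᵇ_)
open import Data.Nat.Properties using (≤-antisym; <⇒<ᵇ; ≡ᵇ⇒≡; ≡⇒≡ᵇ; suc-injective)
open import Data.Nat.ListAction using (sum)
open import Data.Bool using (true; false; T)
open import Data.Fin using (Fin; zero; suc; toℕ; _↑ˡ_; _↑ʳ_; splitAt)
open import Data.Fin.Properties
  using (injective⇒≤; toℕ-injective; toℕ-↑ˡ; toℕ-↑ʳ; toℕ<n; splitAt-↑ˡ; splitAt-↑ʳ; splitAt⁻¹-↑ˡ; splitAt⁻¹-↑ʳ)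
  renaming (suc-injective to Fin-suc-injective)
open import Data.Fin.Subset using (Subset; inside; outside; _∈_; ∣_∣; ⊤)
open import Data.Fin.Subset.Properties using (_∈?_)
open import Data.Vec using (_∷_; here; there; lookup)
import Data.Vec as Vec
open import Data.Vec.Properties using ([]=⇒lookup; lookup⇒[]=; lookup∘tabulate; tabulate-cong; tabulate∘lookup; lookup-replicate)
open import Data.List using (tabulate; _∷_)
open import Data.Sum using (_⊎_; inj₁; inj₂)
open import Data.Product using (Σ; _×_; _,_; proj₁; proj₂)
open import Data.Empty using (⊥-elim)
open import Function using (_∘_)
open import Relation.Nullary using (Dec; yes; no)
open import Relation.Binary.PropositionalEquality
  using (_≡_; _≢_; refl; sym; trans; cong; subst; subst₂; module ≡-Reasoning)

enumerate : ∀ {n} (p : Subset n) → Fin ∣ p ∣ → Fin n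
enumerate (inside  ∷ p) zero    = zero
enumerate (inside  ∷ p) (suc r) = suc (enumerate p r)
enumerate (outside ∷ p) r       = suc (enumerate p r)

enumerate-∈ : ∀ {n} (p : Subset n) r → enumerate p r ∈ p
enumerate-∈ (inside  ∷ p) zero    = here
enumerate-∈ (inside  ∷ p) (suc r) = there (enumerate-∈ p r)
enumerate-∈ (outside ∷ p) r       = there (enumerate-∈ p r)

enumerate-injective : ∀ {n} (p : Subset n) {r r′} → enumerate p r ≡ enumerate p r′ → r ≡ r′
enumerate-injective (inside  ∷ p) {zero}  {zero}   _ = refl
enumerate-injective (inside  ∷ p) {suc r} {suc r′} e = cong suc (enumerate-injective p (Fin-suc-injective e))
enumerate-injective (outside ∷ p)                  e = enumerate-injective p (Fin-suc-injective e)

position : ∀ {n} (p : Subset n) {x} → x ∈ p → Fin ∣ p ∣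
position (inside  ∷ p) here      = zero
position (inside  ∷ p) (there m) = suc (position p m)
position (outside ∷ p) (there m) = position p m

enumerate-position : ∀ {n} (p : Subset n) {x} (x∈p : x ∈ p) → enumerate p (position p x∈p) ≡ x
enumerate-position (inside  ∷ p) here      = refl
enumerate-position (inside  ∷ p) (there m) = cong suc (enumerate-position p m)
enumerate-position (outside ∷ p) (there m) = cong suc (enumerate-position p m)

position-enumerate : ∀ {n} (p : Subset n) r (m : enumerate p r ∈ p) → position p m ≡ r
position-enumerate (inside  ∷ p) zero    here      = refl
position-enumerate (inside  ∷ p) (suc r) (there m) = cong suc (position-enumerate p r m)
position-enumerate (outside ∷ p) r       (there m) = position-enumerate p r m

injectiveOn⇒∣p∣≤∣q∣ : ∀ {m n} (p : Subset m) (q : Subset n) (h : Fin m → Fin n) →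
                      (∀ {x} → x ∈ p → h x ∈ q) →
                      (∀ {x y} → x ∈ p → y ∈ p → h x ≡ h y → x ≡ y) → ∣ p ∣ ≤ ∣ q ∣
injectiveOn⇒∣p∣≤∣q∣ p q h h∈q h-inj = injective⇒≤ {f = h′} h′-injective
  where
  h′ : Fin ∣ p ∣ → Fin ∣ q ∣
  h′ r = position q (h∈q (enumerate-∈ p r))

  h′-injective : ∀ {r r′} → h′ r ≡ h′ r′ → r ≡ r′
  h′-injective {r} {r′} e = enumerate-injective p (h-inj (enumerate-∈ p r) (enumerate-∈ p r′) (begin
    h (enumerate p r)   ≡⟨ sym (enumerate-position q _) ⟩
    enumerate q (h′ r)  ≡⟨ cong (enumerate q) e ⟩
    enumerate q (h′ r′) ≡⟨ enumerate-position q _ ⟩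
    h (enumerate p r′)  ∎))
    where open ≡-Reasoning

preimage : ∀ {m n} → (Fin m → Fin n) → Subset n → Subset m
preimage g A = Vec.tabulate (lookup A ∘ g)

∈-preimage⁻ : ∀ {m n} (g : Fin m → Fin n) A {x} → x ∈ preimage g A → g x ∈ A
∈-preimage⁻ g A {x} x∈ = lookup⇒[]= (g x) A (trans (sym (lookup∘tabulate (lookup A ∘ g) x)) ([]=⇒lookup x∈))

∈-preimage⁺ : ∀ {m n} (g : Fin m → Fin n) A {x} → g x ∈ A → x ∈ preimage g A
∈-preimage⁺ g A {x} gx∈ = lookup⇒[]= x (preimage g A) (trans (lookup∘tabulate (lookup A ∘ g) x) ([]=⇒lookup gx∈))

preimage-⊤ : ∀ {m n} (g : Fin m → Fin n) → preimage g ⊤ ≡ ⊤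
preimage-⊤ g = trans (tabulate-cong λ x → trans (lookup-replicate (g x) true) (sym (lookup-replicate x true)))
                     (tabulate∘lookup ⊤)

adj⇒≢ : ∀ {n} (G : Graph n) {u v} → adj G u v ≡ true → u ≢ v
adj⇒≢ G {u} e refl with () ← trans (sym e) (irrefl G u)

-- Subsets of H are compared with subsets of G through preimages under g = f⁻¹.

module SpanningSupergraph {m n} (G : Graph m) (H : Graph n)
  (f : Fin m → Fin n) (g : Fin n → Fin m)
  (f∘g : ∀ w → f (g w) ≡ w) (g∘f : ∀ u → g (f u) ≡ u)
  (f-adj : ∀ u v → adj G u v ≡ true → adj H (f u) (f v) ≡ true) where

  f-∈ : ∀ A {u} → u ∈ A → f u ∈ preimage g A
  f-∈ A {u} u∈A = ∈-preimage⁺ g A (subst (_∈ A) (sym (g∘f u)) u∈A)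

  ∣preimage∣ : ∀ A → ∣ preimage g A ∣ ≡ ∣ A ∣
  ∣preimage∣ A = ≤-antisym
    (injectiveOn⇒∣p∣≤∣q∣ (preimage g A) A g (∈-preimage⁻ g A)
      λ {x} {y} _ _ e → trans (sym (f∘g x)) (trans (cong f e) (f∘g y)))
    (injectiveOn⇒∣p∣≤∣q∣ A (preimage g A) f (f-∈ A)
      λ {x} {y} _ _ e → trans (sym (g∘f x)) (trans (cong g e) (g∘f y)))

  Reach-map : ∀ {A u v} → Reach G A u v → Reach H (preimage g A) (f u) (f v)
  Reach-map (here u∈A)     = here (f-∈ _ u∈A)
  Reach-map (step r e v∈A) = step (Reach-map r) (f-adj _ _ e) (f-∈ _ v∈A)

  Connected-map : ∀ A → Connected G A → Connected H (preimage g A)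
  Connected-map A ((u , u∈A) , reach) = (f u , f-∈ A u∈A) , λ w w′ w∈ w′∈ →
    subst₂ (Reach H (preimage g A)) (f∘g w) (f∘g w′)
      (Reach-map (reach (g w) (g w′) (∈-preimage⁻ g A w∈) (∈-preimage⁻ g A w′∈)))

  Realizes-map : ∀ {A as P Q} (R : Realizes G A as P) →
                 (∀ i → Q (preimage g (Realizes.part R i))) → Realizes H (preimage g A) as Q
  Realizes-map {A} R good′ = record
    { part     = preimage g ∘ part
    ; size     = λ i → trans (∣preimage∣ (part i)) (size i)
    ; inA      = λ i w w∈ → ∈-preimage⁺ g A (inA i (g w) (∈-preimage⁻ g (part i) w∈))
    ; covers   = λ w w∈ → let (i , gw∈) = covers (g w) (∈-preimage⁻ g A w∈)
                          in i , ∈-preimage⁺ g (part i) gw∈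
    ; disjoint = λ i j w w∈i w∈j →
                   disjoint i j (g w) (∈-preimage⁻ g (part i) w∈i) (∈-preimage⁻ g (part j) w∈j)
    ; good     = good′ }
    where open Realizes R

  IsIntPartition-preimage : ∀ A {as} → IsIntPartition H ∣ preimage g A ∣ as → IsIntPartition G ∣ A ∣ as
  IsIntPartition-preimage A (positive , total) = positive , trans total (∣preimage∣ A)

  RPon-map : ∀ A → RPon G A → RPon H (preimage g A)
  RPon-map A (single ∣A∣≡1) = single (trans (∣preimage∣ A) ∣A∣≡1)
  RPon-map A (split conn parts) = split (Connected-map A conn) λ as ip len →
    let R = parts as (IsIntPartition-preimage A ip) len
    in Realizes-map R λ i → RPon-map _ (Realizes.good R i)

  APon-map : ∀ A → APon G A → APon H (preimage g A)
  APon-map A ap as ip = Realizes-map R λ i → Connected-map _ (Realizes.good R i)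
    where R = ap as (IsIntPartition-preimage A ip)

  RP-map : RP G → RP H
  RP-map rp = subst (RPon H) (preimage-⊤ g) (RPon-map ⊤ rp)

  AP-map : AP G → AP H
  AP-map ap = subst (APon H) (preimage-⊤ g) (APon-map ⊤ ap)

inBlock : ∀ {k} (d : Fin k → ℕ) (j : Fin k) → Fin (d j) → Fin (sum (tabulate d))
inBlock d zero    r = r ↑ˡ _
inBlock d (suc j) r = d zero ↑ʳ inBlock (d ∘ suc) j r

blockCoords : ∀ {k} (d : Fin k → ℕ) → Fin (sum (tabulate d)) → Σ (Fin k) (Fin ∘ d)
blockCoords {suc k} d w with splitAt (d zero) w
... | inj₁ r  = zero , r
... | inj₂ w′ = let (j , r) = blockCoords (d ∘ suc) w′ in suc j , r

blockCoords-inBlock : ∀ {k} (d : Fin k → ℕ) j r → blockCoords d (inBlock d j r) ≡ (j , r)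
blockCoords-inBlock d zero r
  rewrite splitAt-↑ˡ (d zero) r (sum (tabulate (d ∘ suc))) = refl
blockCoords-inBlock d (suc j) r
  rewrite splitAt-↑ʳ (d zero) (sum (tabulate (d ∘ suc))) (inBlock (d ∘ suc) j r)
        | blockCoords-inBlock (d ∘ suc) j r = refl

inBlock-blockCoords : ∀ {k} (d : Fin k → ℕ) w → let (j , r) = blockCoords d w in inBlock d j r ≡ w
inBlock-blockCoords {suc k} d w with splitAt (d zero) w in eq
... | inj₁ r  = splitAt⁻¹-↑ˡ eq
... | inj₂ w′ = trans (cong (d zero ↑ʳ_) (inBlock-blockCoords (d ∘ suc) w′)) (splitAt⁻¹-↑ʳ eq)

blockOf-< : ∀ {c} cs {j} → j < c → blockOf (c ∷ cs) j ≡ 0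
blockOf-< {c} cs {j} j<c with j <ᵇ c | <⇒<ᵇ j<c
... | true | _ = refl

blockOf-+ : ∀ c cs j → blockOf (c ∷ cs) (c + j) ≡ suc (blockOf cs j)
blockOf-+ zero    cs j = refl
blockOf-+ (suc c) cs j = blockOf-+ c cs j

blockOf-inBlock : ∀ {k} (d : Fin k → ℕ) j r → blockOf (tabulate d) (toℕ (inBlock d j r)) ≡ toℕ j
blockOf-inBlock d zero r = begin
  blockOf (tabulate d) (toℕ (r ↑ˡ _)) ≡⟨ cong (blockOf (tabulate d)) (toℕ-↑ˡ r _) ⟩
  blockOf (tabulate d) (toℕ r)        ≡⟨ blockOf-< (tabulate (d ∘ suc)) (toℕ<n r) ⟩
  0                                   ∎
  where open ≡-Reasoning
blockOf-inBlock d (suc j) r = begin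
  blockOf (tabulate d) (toℕ (d zero ↑ʳ w))  ≡⟨ cong (blockOf (tabulate d)) (toℕ-↑ʳ (d zero) w) ⟩
  blockOf (tabulate d) (d zero + toℕ w)     ≡⟨ blockOf-+ (d zero) (tabulate (d ∘ suc)) (toℕ w) ⟩
  suc (blockOf (tabulate (d ∘ suc)) (toℕ w)) ≡⟨ cong suc (blockOf-inBlock (d ∘ suc) j r) ⟩
  suc (toℕ j)                               ∎
  where
  open ≡-Reasoning
  w = inBlock (d ∘ suc) j r

-- blockOf (s ∷ cs) treats the centre of the semistar as block 0.

semistar-adj : ∀ s cs (x y : Fin (s + sum cs)) → x ≢ y →
               blockOf (s ∷ cs) (toℕ x) ≡ 0 ⊎ blockOf (s ∷ cs) (toℕ y) ≡ 0 ⊎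
                 blockOf (s ∷ cs) (toℕ x) ≡ blockOf (s ∷ cs) (toℕ y) →
               adj (semistar s cs) x y ≡ true
semistar-adj s cs x y x≢y blocks with toℕ x ≡ᵇ toℕ y in x≡ᵇy
... | true  = ⊥-elim (x≢y (toℕ-injective (≡ᵇ⇒≡ (toℕ x) (toℕ y) (subst T (sym x≡ᵇy) _))))
... | false with toℕ x <ᵇ s | toℕ y <ᵇ s
...   | true  | _     = refl
...   | false | true  = refl
...   | false | false with blocks
...     | inj₁ ()
...     | inj₂ (inj₁ ())
...     | inj₂ (inj₂ same) with blockOf cs (toℕ x ∸ s) ≡ᵇ blockOf cs (toℕ y ∸ s) in b≡ᵇ
...       | true  = refl
...       | false = ⊥-elim (subst T b≡ᵇ (≡⇒≡ᵇ _ _ (suc-injective same)))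

module ComponentBlocks {n} (G : Graph n) (S : Subset n) (k : ℕ) (C : Fin k → Subset n)
  (components : IsComponents G S k C) where
  open IsComponents components

  part : Fin (suc k) → Subset n
  part zero    = S
  part (suc i) = C i

  partSize : Fin (suc k) → ℕ
  partSize j = ∣ part j ∣

  -- tabulate partSize reduces to ∣ S ∣ ∷ tabulate (∣_∣ ∘ C), so the vertex
  -- set below is definitionally that of the semistar.
  Semistar : Graph (sum (tabulate partSize))
  Semistar = semistar ∣ S ∣ (tabulate (λ i → ∣ C i ∣))

  classify : ∀ u → Σ (Fin (suc k)) (λ j → u ∈ part j)
  classify u with u ∈? S
  ... | yes u∈S = zero , u∈S
  ... | no  u∉S = let (i , u∈C) = covers u u∉S in suc i , u∈C

  partOf : Fin n → Fin (suc k)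
  partOf u = proj₁ (classify u)

  partOf-unique : ∀ {u} j → u ∈ part j → partOf u ≡ j
  partOf-unique {u} zero u∈S with u ∈? S
  ... | yes _   = refl
  ... | no  u∉S = ⊥-elim (u∉S u∈S)
  partOf-unique {u} (suc i) u∈C with u ∈? S
  ... | yes u∈S = ⊥-elim (avoidsS i u u∈C u∈S)
  ... | no  u∉S = cong suc (disjoint _ i u (proj₂ (covers u u∉S)) u∈C)

  to : Fin n → Fin (sum (tabulate partSize))
  to u = inBlock partSize (partOf u) (position (part (partOf u)) (proj₂ (classify u)))

  from : Fin (sum (tabulate partSize)) → Fin n
  from w = let (j , r) = blockCoords partSize w in enumerate (part j) r

  from∘to : ∀ u → from (to u) ≡ u
  from∘to u rewrite blockCoords-inBlock partSize (partOf u) (position (part (partOf u)) (proj₂ (classify u)))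
    = enumerate-position (part (partOf u)) _

  to∘from : ∀ w → to (from w) ≡ w
  to∘from w = trans (to-enumerate (partOf v) (partOf-unique j v∈) (proj₂ (classify v)))
                    (inBlock-blockCoords partSize w)
    where
    j = proj₁ (blockCoords partSize w)
    r = proj₂ (blockCoords partSize w)
    v = enumerate (part j) r
    v∈ = enumerate-∈ (part j) r
    to-enumerate : ∀ j′ → j′ ≡ j → (m : v ∈ part j′) →
                   inBlock partSize j′ (position (part j′) m) ≡ inBlock partSize j r
    to-enumerate j′ refl m = cong (inBlock partSize j) (position-enumerate (part j) r m)

  block : Fin (sum (tabulate partSize)) → ℕ
  block w = blockOf (tabulate partSize) (toℕ w)

  blockOf-to : ∀ {u} j → u ∈ part j → block (to u) ≡ toℕ j
  blockOf-to {u} j u∈ = trans (blockOf-inBlock partSize (partOf u) _) (cong toℕ (partOf-unique j u∈))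

  adjacent-blocks : ∀ {u v} → adj G u v ≡ true → Dec (u ∈ S) → Dec (v ∈ S) →
                    block (to u) ≡ 0 ⊎ block (to v) ≡ 0 ⊎ block (to u) ≡ block (to v)
  adjacent-blocks         e (yes u∈S) _         = inj₁ (blockOf-to zero u∈S)
  adjacent-blocks         e (no _)    (yes v∈S) = inj₂ (inj₁ (blockOf-to zero v∈S))
  adjacent-blocks {u} {v} e (no u∉S)  (no v∉S)  =
    let (i , u∈C) = covers u u∉S
    in inj₂ (inj₂ (trans (blockOf-to (suc i) u∈C) (sym (blockOf-to (suc i) (closed i u v u∈C e v∉S)))))

  to-adj : ∀ u v → adj G u v ≡ true → adj Semistar (to u) (to v) ≡ true
  to-adj u v e = semistar-adj ∣ S ∣ (tabulate (λ i → ∣ C i ∣)) (to u) (to v) to-u≢to-v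
                   (adjacent-blocks e (u ∈? S) (v ∈? S))
    where
    to-u≢to-v : to u ≢ to v
    to-u≢to-v eq = adj⇒≢ G e (trans (sym (from∘to u)) (trans (cong from eq) (from∘to v)))

mainTheorem19 : ∀ {n} (G : Graph n) (S : Subset n) → IsVertexCut G S →
                  (k : ℕ) (C : Fin k → Subset n) → IsComponents G S k C →
                  (RP G → RP (semistar ∣ S ∣ (tabulate (λ i → ∣ C i ∣)))) ×
                  (AP G → AP (semistar ∣ S ∣ (tabulate (λ i → ∣ C i ∣))))
mainTheorem19 G S _ k C components = RP-map , AP-map
  where
  open ComponentBlocks G S k C components
  open SpanningSupergraph G Semistar to from to∘from from∘to to-adj
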